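{- For each integer $n\ge 0$ let $\rho(n)$ denote the number of partitions of $n$ of type $\Lambda$, i.e. partitions of $n$ in which the largest part $\ell$ appears exactly once and the remaining parts (all strictly smaller than $\ell$) form a partition of $\ell$. Then, as formal power series in $q$ (or for $|q|<1$), $$\sum_{n=0}^{\infty}\rho(n)q^n=\frac{1}{(q^2;q^2)_{\infty}}-\frac{1}{1-q^2}.$$
   Context: A partition of a positive integer $n$ is a way of writing $n$ as a sum of positive integers (parts), listed in non-increasing order; the empty partition is the only partition of $0$ and has no largest part, so it is not of type $\Lambda$. For $|q|<1$, $(t;q)_0=1$, $(t;q)_n=(1-t)(1-tq)\cdots(1-tq^{n-1})$ for $n>0$, and $(t;q)_\infty=\lim_{n\to\infty}(t;q)_n$. -}

module Defs where

open import Data.Nat as ℕ using (ℕ; zero; suc; _≥_; _<_; _∸_)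
open import Data.Integer as ℤ using (ℤ; +_; _-_)
open import Data.List using (List; []; _∷_; foldr; map; upTo)
open import Data.Nat.ListAction using (sum)
open import Data.Empty using (⊥)
open import Relation.Nullary using (yes; no)
open import Data.List.Relation.Unary.All using (All)
open import Data.List.Relation.Unary.Linked using (Linked)
open import Data.Product using (Σ; _×_)
open import Relation.Binary.PropositionalEquality using (_≡_)

record IsPartition (n : ℕ) (λs : List ℕ) : Set where
  field
    positive    : All (0 ℕ.<_) λs
    nonIncr     : Linked _≥_ λs
    sumEq       : sum λs ≡ n

-- Type Λ: nonempty, largest part ℓ appears exactly once (all other parts
-- are strictly smaller than ℓ), and the remaining parts sum to ℓ
-- (so they form a partition of ℓ, being positive and non-increasing).
TypeΛ : List ℕ → Set
TypeΛ []       = ⊥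
TypeΛ (ℓ ∷ rest) = All (_< ℓ) rest × sum rest ≡ ℓ

ΛPartition : ℕ → Set
ΛPartition n = Σ (List ℕ) (λ λs → IsPartition n λs × TypeΛ λs)

FPS : Set
FPS = ℕ → ℤ

sumℤ : List ℤ → ℤ
sumℤ = foldr ℤ._+_ (+ 0)

_⋆_ : FPS → FPS → FPS
(f ⋆ g) n = sumℤ (map (λ k → f k ℤ.* g (n ∸ k)) (upTo (suc n)))

one : FPS
one zero    = + 1
one (suc _) = + 0

mono : ℕ → FPS
mono m n with m ℕ.≟ n
... | yes _ = + 1
... | no  _ = + 0

_⊖_ : FPS → FPS → FPS
(f ⊖ g) n = f n - g n

oneMinusQ2 : FPS
oneMinusQ2 = one ⊖ mono 2

poch2 : ℕ → FPS
poch2 zero    = one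
poch2 (suc N) = poch2 N ⋆ (one ⊖ mono (2 ℕ.* suc N))

-- infinite product (q^2;q^2)_∞ as a formal power series: its n-th coefficient
-- is the n-th coefficient of any partial product with N ≥ n (the factors
-- 1 - q^{2i} with 2i > n do not affect coefficients of degree ≤ n).
poch2∞ : FPS
poch2∞ n = poch2 n n

IsInverse : FPS → FPS → Set
IsInverse f g = ∀ n → (f ⋆ g) n ≡ one n

-- A partition of type Λ of n is ℓ followed by a partition of ℓ into parts
-- smaller than ℓ, so ρ(2ℓ) = p(ℓ) − 1 for ℓ ≥ 1 and ρ vanishes elsewhere.
-- On the series side, 1/(1 − q²) = Σ q^{2m}, and 1/(q²;q²)_N = Σ p≤N(m) q^{2m}
-- with p≤N(m) the number of partitions of m into parts ≤ N: multiplying by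
-- 1 − q^{2N} is the recurrence p≤N(m) = p≤(N−1)(m) + p≤N(m − N), which splits
-- off one copy of the part N. Letting N → ∞ coefficientwise and using that
-- inverses of series with constant term 1 are unique gives the identity.
module Submission where

open import Defs
open import Data.Empty using (⊥; ⊥-elim)
open import Data.Fin using (Fin; zero)
open import Data.Fin.Permutation using (↔⇒≡)
open import Data.Fin.Properties using (+↔⊎)
open import Data.Integer using (ℤ; +_; _+_; _-_; _*_)
import Data.Integer.Properties as ℤ
open import Algebra.Properties.AbelianGroup ℤ.+-0-abelianGroup using (∙-cancelʳ)
open import Algebra.Properties.CommutativeSemigroup ℤ.+-commutativeSemigroup using (interchange)
open import Data.Integer.Tactic.RingSolver using (solve-∀)
open import Data.List using (List; []; _∷_; map; applyUpTo)
open import Data.List.Relation.Unary.All as All using (All; []; _∷_)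
open import Data.List.Relation.Unary.Linked as Linked using (Linked; []; [-]; _∷_)
open import Data.List.Relation.Unary.Linked.Properties using (Linked⇒All)
open import Data.Nat as ℕ
  using (ℕ; zero; suc; _∸_; _≤_; _<_; _≤′_; _≥_; z≤n; s≤s; z<s; ≤′-refl; ≤′-step)
open import Data.Nat.Induction using (<-rec)
open import Data.Nat.ListAction using (sum)
open import Data.Nat.Properties
  using ( ≤-refl; ≤-trans; ≤-pred; <-≤-trans; m<n⇒m<1+n; m≤n⇒m≤1+n; ≤∧≢⇒<; <⇒≱; <-irrefl
        ; ≤⇒≤′; ≤′⇒≤
        ; m≤m+n; ≤-irrelevant; <-irrelevant; ≡-irrelevant; m≤n+m; m∸n≤m; n∸n≡0; +-∸-assoc
        ; ∸-monoʳ-<; m+n∸m≡n; m+[n∸m]≡n; ∸-+-assoc; +-identityʳ; +-suc; suc-injective; n≡⌊n+n/2⌋ )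
open import Data.Product using (Σ; ∃-syntax; _×_; _,_; proj₁; proj₂)
open import Data.Sum using (_⊎_; inj₁; inj₂)
open import Data.Sum.Function.Propositional using (_⊎-↔_)
open import Function using (_∘_; flip)
open import Function.Bundles using (_↔_; mk↔ₛ′; Inverse)
open import Function.Properties.Inverse using (↔-trans; ↔-sym)
open import Relation.Nullary using (¬_; yes; no)
open import Relation.Nullary.Irrelevant using (Irrelevant)
open import Relation.Binary.PropositionalEquality

open IsPartition

x+y-y≡x : ∀ (x y : ℤ) → x + y - y ≡ x
x+y-y≡x = solve-∀

Σ< : ℕ → (ℕ → ℤ) → ℤ
Σ< zero    F = + 0
Σ< (suc n) F = Σ< n F + F n

Σ<-cong : ∀ n {F G : ℕ → ℤ} → (∀ k → k < n → F k ≡ G k) → Σ< n F ≡ Σ< n G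
Σ<-cong zero    F≗G = refl
Σ<-cong (suc n) F≗G = cong₂ _+_ (Σ<-cong n (λ k → F≗G k ∘ m<n⇒m<1+n)) (F≗G n ≤-refl)

Σ<-zero : ∀ n {F : ℕ → ℤ} → (∀ k → k < n → F k ≡ + 0) → Σ< n F ≡ + 0
Σ<-zero zero    F≗0 = refl
Σ<-zero (suc n) F≗0 = cong₂ _+_ (Σ<-zero n (λ k → F≗0 k ∘ m<n⇒m<1+n)) (F≗0 n ≤-refl)

Σ<-head : ∀ n F → Σ< (suc n) F ≡ F 0 + Σ< n (F ∘ suc)
Σ<-head zero    F = ℤ.+-comm (+ 0) (F 0)
Σ<-head (suc n) F = trans (cong (_+ F (suc n)) (Σ<-head n F)) (ℤ.+-assoc (F 0) _ _)

Σ<-+ : ∀ n F G → Σ< n (λ k → F k + G k) ≡ Σ< n F + Σ< n G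
Σ<-+ zero    F G = refl
Σ<-+ (suc n) F G = trans (cong (_+ (F n + G n)) (Σ<-+ n F G)) (interchange (Σ< n F) (Σ< n G) (F n) (G n))

Σ<-- : ∀ n F G → Σ< n (λ k → F k - G k) ≡ Σ< n F - Σ< n G
Σ<-- zero    F G = refl
Σ<-- (suc n) F G = trans (cong (_+ (F n - G n)) (Σ<-- n F G)) (regroup (Σ< n F) (Σ< n G) (F n) (G n))
  where
  regroup : ∀ a b c d → (a - b) + (c - d) ≡ (a + c) - (b + d)
  regroup = solve-∀

Σ<-*ˡ : ∀ n a F → Σ< n (λ k → a * F k) ≡ a * Σ< n F
Σ<-*ˡ zero    a F = sym (ℤ.*-zeroʳ a)
Σ<-*ˡ (suc n) a F = trans (cong (_+ a * F n) (Σ<-*ˡ n a F)) (sym (ℤ.*-distribˡ-+ a (Σ< n F) (F n)))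

Σ<-*ʳ : ∀ n a F → Σ< n (λ k → F k * a) ≡ Σ< n F * a
Σ<-*ʳ zero    a F = refl
Σ<-*ʳ (suc n) a F = trans (cong (_+ F n * a) (Σ<-*ʳ n a F)) (sym (ℤ.*-distribʳ-+ a (Σ< n F) (F n)))

-- Both sides sum F j k over 0 ≤ j ≤ k ≤ n.
Σ<-triangle : ∀ n (F : ℕ → ℕ → ℤ) →
  Σ< (suc n) (λ k → Σ< (suc k) (λ j → F j k)) ≡
  Σ< (suc n) (λ j → Σ< (suc (n ∸ j)) (λ i → F j (j ℕ.+ i)))
Σ<-triangle zero    F = refl
Σ<-triangle (suc n) F = begin
  Σ< (suc n) Row + (Σ< (suc n) Column + F (suc n) (suc n))
    ≡⟨ cong₂ _+_ (Σ<-triangle n F) refl ⟩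
  Σ< (suc n) (Inner n) + (Σ< (suc n) Column + F (suc n) (suc n))
    ≡⟨ sym (ℤ.+-assoc (Σ< (suc n) (Inner n)) (Σ< (suc n) Column) (F (suc n) (suc n))) ⟩
  (Σ< (suc n) (Inner n) + Σ< (suc n) Column) + F (suc n) (suc n)
    ≡⟨ cong₂ _+_ (sym (Σ<-+ (suc n) (Inner n) Column)) corner ⟩
  Σ< (suc n) (λ j → Inner n j + Column j) + Inner (suc n) (suc n)
    ≡⟨ cong₂ _+_ (Σ<-cong (suc n) (λ j → extend j ∘ ≤-pred)) refl ⟩
  Σ< (suc (suc n)) (Inner (suc n)) ∎
  where
  open ≡-Reasoning
  Row Column : ℕ → ℤ
  Row k = Σ< (suc k) (λ j → F j k)
  Column j = F j (suc n)
  Inner : ℕ → ℕ → ℤ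
  Inner m j = Σ< (suc (m ∸ j)) (λ i → F j (j ℕ.+ i))
  corner : F (suc n) (suc n) ≡ Inner (suc n) (suc n)
  corner = begin
    F (suc n) (suc n)        ≡⟨ cong (F (suc n)) (sym (+-identityʳ _)) ⟩
    F (suc n) (suc n ℕ.+ 0)  ≡⟨ ℤ.+-identityˡ _ ⟨
    Σ< 1 Diagonal            ≡⟨ cong (λ m → Σ< (suc m) Diagonal) (n∸n≡0 n) ⟨
    Inner (suc n) (suc n)    ∎
    where
    Diagonal : ℕ → ℤ
    Diagonal i = F (suc n) (suc n ℕ.+ i)
  extend : ∀ j → j ≤ n → Inner n j + Column j ≡ Inner (suc n) j
  extend j j≤n rewrite +-∸-assoc 1 j≤n =
    cong (λ m → Inner n j + F j m) (trans (cong suc (sym (m+[n∸m]≡n j≤n))) (sym (+-suc j (n ∸ j))))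

sumℤ-map-applyUpTo : ∀ n (F : ℕ → ℤ) g → sumℤ (map F (applyUpTo g n)) ≡ Σ< n (F ∘ g)
sumℤ-map-applyUpTo zero    F g = refl
sumℤ-map-applyUpTo (suc n) F g =
  trans (cong (λ x → F (g 0) + x) (sumℤ-map-applyUpTo n F (g ∘ suc))) (sym (Σ<-head n (F ∘ g)))

⋆-coeff : ∀ f g n → (f ⋆ g) n ≡ Σ< (suc n) (λ k → f k * g (n ∸ k))
⋆-coeff f g n = sumℤ-map-applyUpTo (suc n) (λ k → f k * g (n ∸ k)) (λ k → k)

⋆-head : ∀ f g n → (f ⋆ g) n ≡ f 0 * g n + Σ< n (λ k → f (suc k) * g (n ∸ suc k))
⋆-head f g n = trans (⋆-coeff f g n) (Σ<-head n _)

⋆-cong : ∀ f g {f′ g′} n → (∀ k → k ≤ n → f k ≡ f′ k) → (∀ k → k ≤ n → g k ≡ g′ k) →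
         (f ⋆ g) n ≡ (f′ ⋆ g′) n
⋆-cong f g {f′} {g′} n f≗f′ g≗g′ = begin
  (f ⋆ g) n                              ≡⟨ ⋆-coeff f g n ⟩
  Σ< (suc n) (λ k → f k * g (n ∸ k))     ≡⟨ Σ<-cong (suc n) term ⟩
  Σ< (suc n) (λ k → f′ k * g′ (n ∸ k))   ≡⟨ ⋆-coeff f′ g′ n ⟨
  (f′ ⋆ g′) n                            ∎
  where
  open ≡-Reasoning
  term : ∀ k → k < suc n → f k * g (n ∸ k) ≡ f′ k * g′ (n ∸ k)
  term k k<1+n = cong₂ _*_ (f≗f′ k (≤-pred k<1+n)) (g≗g′ (n ∸ k) (m∸n≤m n k))

⋆-assoc : ∀ f g h n → ((f ⋆ g) ⋆ h) n ≡ (f ⋆ (g ⋆ h)) n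
⋆-assoc f g h n = begin
  ((f ⋆ g) ⋆ h) n
    ≡⟨ ⋆-coeff (f ⋆ g) h n ⟩
  Σ< (suc n) (λ k → (f ⋆ g) k * h (n ∸ k))
    ≡⟨ Σ<-cong (suc n) (λ k _ → trans (cong (_* h (n ∸ k)) (⋆-coeff f g k)) (sym (Σ<-*ʳ (suc k) _ _))) ⟩
  Σ< (suc n) (λ k → Σ< (suc k) (λ j → F j k))
    ≡⟨ Σ<-triangle n F ⟩
  Σ< (suc n) (λ j → Σ< (suc (n ∸ j)) (λ i → F j (j ℕ.+ i)))
    ≡⟨ Σ<-cong (suc n) (λ j _ →
         trans (Σ<-cong (suc (n ∸ j)) (λ i _ → reassociate j i)) (Σ<-*ˡ (suc (n ∸ j)) (f j) _)) ⟩
  Σ< (suc n) (λ j → f j * Σ< (suc (n ∸ j)) (λ i → g i * h (n ∸ j ∸ i)))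
    ≡⟨ Σ<-cong (suc n) (λ j _ → cong (f j *_) (sym (⋆-coeff g h (n ∸ j)))) ⟩
  Σ< (suc n) (λ j → f j * (g ⋆ h) (n ∸ j))
    ≡⟨ ⋆-coeff f (g ⋆ h) n ⟨
  (f ⋆ (g ⋆ h)) n ∎
  where
  open ≡-Reasoning
  F : ℕ → ℕ → ℤ
  F j k = f j * g (k ∸ j) * h (n ∸ k)
  reassociate : ∀ j i → F j (j ℕ.+ i) ≡ f j * (g i * h (n ∸ j ∸ i))
  reassociate j i rewrite m+n∸m≡n j i | ∸-+-assoc n j i = ℤ.*-assoc (f j) (g i) (h (n ∸ (j ℕ.+ i)))

⋆-distribʳ-⊖ : ∀ f g h n → ((f ⊖ g) ⋆ h) n ≡ (f ⋆ h) n - (g ⋆ h) n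
⋆-distribʳ-⊖ f g h n = begin
  ((f ⊖ g) ⋆ h) n
    ≡⟨ ⋆-coeff (f ⊖ g) h n ⟩
  Σ< (suc n) (λ k → (f k - g k) * h (n ∸ k))
    ≡⟨ Σ<-cong (suc n) (λ k _ → distrib (f k) (g k) (h (n ∸ k))) ⟩
  Σ< (suc n) (λ k → f k * h (n ∸ k) - g k * h (n ∸ k))
    ≡⟨ Σ<-- (suc n) _ _ ⟩
  Σ< (suc n) (λ k → f k * h (n ∸ k)) - Σ< (suc n) (λ k → g k * h (n ∸ k))
    ≡⟨ cong₂ _-_ (⋆-coeff f h n) (⋆-coeff g h n) ⟨
  (f ⋆ h) n - (g ⋆ h) n ∎
  where
  open ≡-Reasoning
  distrib : ∀ a b c → (a - b) * c ≡ a * c - b * c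
  distrib = solve-∀

mono-refl : ∀ s → mono s s ≡ + 1
mono-refl s with s ℕ.≟ s
... | yes _   = refl
... | no  s≢s = ⊥-elim (s≢s refl)

mono-≢ : ∀ {s k} → s ≢ k → mono s k ≡ + 0
mono-≢ {s} {k} s≢k with s ℕ.≟ k
... | yes s≡k = ⊥-elim (s≢k s≡k)
... | no  _   = refl

mono-suc : ∀ s k → mono (suc s) (suc k) ≡ mono s k
mono-suc s k with s ℕ.≟ k
... | yes refl = mono-refl (suc s)
... | no  s≢k  = mono-≢ (s≢k ∘ suc-injective)

one≗mono0 : ∀ k → one k ≡ mono 0 k
one≗mono0 zero    = refl
one≗mono0 (suc k) = refl

-- shift z s C is C delayed by s places and padded with z; on series with
-- z = + 0 it is multiplication by q^s.
shift : {A : Set} → A → ℕ → (ℕ → A) → ℕ → A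
shift z zero    C n       = C n
shift z (suc s) C zero    = z
shift z (suc s) C (suc n) = shift z s C n

shift-cong : ∀ {A : Set} {z : A} s m {C D : ℕ → A} →
             (∀ x → s ℕ.+ x ≡ m → C x ≡ D x) → shift z s C m ≡ shift z s D m
shift-cong zero    m       C≗D = C≗D m refl
shift-cong (suc s) zero    C≗D = refl
shift-cong (suc s) (suc m) C≗D = shift-cong s m (λ x → C≗D x ∘ cong suc)

shift-below : ∀ {A : Set} {z : A} s m {C : ℕ → A} → m < s → shift z s C m ≡ z
shift-below (suc s) zero    m<s       = refl
shift-below (suc s) (suc m) (s≤s m<s) = shift-below s m m<s

shift-self : ∀ {A : Set} {z : A} s {C : ℕ → A} → shift z s C s ≡ C 0
shift-self zero    = refl
shift-self (suc s) = shift-self s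

mono-⋆ : ∀ s C n → (mono s ⋆ C) n ≡ shift (+ 0) s C n
mono-⋆ zero C n = begin
  (mono 0 ⋆ C) n
    ≡⟨ ⋆-head (mono 0) C n ⟩
  + 1 * C n + Σ< n (λ k → + 0 * C (n ∸ suc k))
    ≡⟨ cong₂ _+_ (ℤ.*-identityˡ (C n)) (Σ<-zero n (λ _ _ → refl)) ⟩
  C n + + 0
    ≡⟨ ℤ.+-identityʳ (C n) ⟩
  C n ∎
  where open ≡-Reasoning
mono-⋆ (suc s) C zero    = refl
mono-⋆ (suc s) C (suc n) = begin
  (mono (suc s) ⋆ C) (suc n)
    ≡⟨ ⋆-head (mono (suc s)) C (suc n) ⟩
  + 0 + Σ< (suc n) (λ k → mono (suc s) (suc k) * C (n ∸ k))
    ≡⟨ ℤ.+-identityˡ _ ⟩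
  Σ< (suc n) (λ k → mono (suc s) (suc k) * C (n ∸ k))
    ≡⟨ Σ<-cong (suc n) (λ k _ → cong (_* C (n ∸ k)) (mono-suc s k)) ⟩
  Σ< (suc n) (λ k → mono s k * C (n ∸ k))
    ≡⟨ ⋆-coeff (mono s) C n ⟨
  (mono s ⋆ C) n
    ≡⟨ mono-⋆ s C n ⟩
  shift (+ 0) s C n ∎
  where open ≡-Reasoning

⋆-identityˡ : ∀ C n → (one ⋆ C) n ≡ C n
⋆-identityˡ C n = trans (⋆-cong one C n (λ k _ → one≗mono0 k) (λ _ _ → refl)) (mono-⋆ 0 C n)

one-⊖-mono-⋆ : ∀ s C n → ((one ⊖ mono s) ⋆ C) n ≡ C n - shift (+ 0) s C n
one-⊖-mono-⋆ s C n =
  trans (⋆-distribʳ-⊖ one (mono s) C n) (cong₂ _-_ (⋆-identityˡ C n) (mono-⋆ s C n))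

one-⊖-mono-below : ∀ {s j} → j < s → (one ⊖ mono s) j ≡ one j
one-⊖-mono-below {j = j} j<s =
  trans (cong (one j -_) (mono-≢ (λ s≡j → <-irrefl (sym s≡j) j<s))) (ℤ.+-identityʳ (one j))

⋆-identityʳ-upTo : ∀ f g n → (∀ k → k ≤ n → g k ≡ one k) → (f ⋆ g) n ≡ f n
⋆-identityʳ-upTo f g n g≗one = begin
  (f ⋆ g) n
    ≡⟨ ⋆-coeff f g n ⟩
  Σ< n (λ k → f k * g (n ∸ k)) + f n * g (n ∸ n)
    ≡⟨ cong₂ _+_ (Σ<-zero n lower) (cong (λ m → f n * g m) (n∸n≡0 n)) ⟩
  + 0 + f n * g 0
    ≡⟨ ℤ.+-identityˡ _ ⟩
  f n * g 0
    ≡⟨ cong (f n *_) (g≗one 0 z≤n) ⟩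
  f n * + 1
    ≡⟨ ℤ.*-identityʳ (f n) ⟩
  f n ∎
  where
  open ≡-Reasoning
  lower : ∀ k → k < n → f k * g (n ∸ k) ≡ + 0
  lower k k<n = trans (cong (f k *_) (trans (g≗one (n ∸ k) (m∸n≤m n k)) (cong one (+-∸-assoc 1 k<n))))
                      (ℤ.*-zeroʳ (f k))

inverse-unique : ∀ f g h → f 0 ≡ + 1 → IsInverse f g → IsInverse f h → ∀ n → g n ≡ h n
inverse-unique f g h f₀≡1 fg≡1 fh≡1 = <-rec (λ n → g n ≡ h n) step
  where
  open ≡-Reasoning
  rest : (ℕ → ℤ) → ℕ → ℤ
  rest u n = Σ< n (λ k → f (suc k) * u (n ∸ suc k))
  expand : ∀ u n → (f ⋆ u) n ≡ u n + rest u n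
  expand u n = trans (⋆-head f u n) (cong (_+ rest u n) (trans (cong (_* u n) f₀≡1) (ℤ.*-identityˡ (u n))))
  step : ∀ n → (∀ {j} → j < n → g j ≡ h j) → g n ≡ h n
  step n g≡h = ∙-cancelʳ (rest g n) (g n) (h n) (begin
    g n + rest g n   ≡⟨ expand g n ⟨
    (f ⋆ g) n        ≡⟨ trans (fg≡1 n) (sym (fh≡1 n)) ⟩
    (f ⋆ h) n        ≡⟨ expand h n ⟩
    h n + rest h n   ≡⟨ cong (λ x → h n + x) (Σ<-cong n earlier) ⟩
    h n + rest g n   ∎)
    where
    earlier : ∀ k → k < n → f (suc k) * h (n ∸ suc k) ≡ f (suc k) * g (n ∸ suc k)
    earlier k k<n = cong (f (suc k) *_) (sym (g≡h (∸-monoʳ-< z<s k<n)))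

inverse-limit : ∀ {F G} (f g : ℕ → FPS) → (∀ N → IsInverse (f N) (g N)) →
                (∀ {k N} → k ≤ N → f N k ≡ F k) → (∀ {k N} → k ≤ N → g N k ≡ G k) →
                IsInverse F G
inverse-limit {F} {G} f g fg≡1 f≈F g≈G n =
  trans (⋆-cong F G n (λ _ k≤n → sym (f≈F k≤n)) (λ _ k≤n → sym (g≈G k≤n))) (fg≡1 n n)

Partition≤ : ℕ → ℕ → Set
Partition≤ N m = Σ (List ℕ) λ xs → IsPartition m xs × All (_≤ N) xs

Σ-≡-proj₁ : ∀ {A : Set} {P : A → Set} → (∀ {x} → Irrelevant (P x)) →
            {p q : Σ A P} → proj₁ p ≡ proj₁ q → p ≡ q
Σ-≡-proj₁ P-irrelevant {x , a} {.x , b} refl = cong (x ,_) (P-irrelevant a b)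

IsPartition-irrelevant : ∀ {m xs} → Irrelevant (IsPartition m xs)
IsPartition-irrelevant record { positive = a ; nonIncr = b ; sumEq = c }
                       record { positive = a′ ; nonIncr = b′ ; sumEq = c′ }
  with All.irrelevant <-irrelevant a a′ | Linked.irrelevant ≤-irrelevant b b′ | ≡-irrelevant c c′
... | refl | refl | refl = refl

Partition≤-≡ : ∀ {N m} {p q : Partition≤ N m} → proj₁ p ≡ proj₁ q → p ≡ q
Partition≤-≡ = Σ-≡-proj₁ λ (π , b) (π′ , b′) →
  cong₂ _,_ (IsPartition-irrelevant π π′) (All.irrelevant ≤-irrelevant b b′)

parts≤head : ∀ {m x xs} → IsPartition m (x ∷ xs) → All (_≤ x) xs
parts≤head π = All.tail (Linked⇒All (flip ≤-trans) ≤-refl (nonIncr π))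

head≤sum : ∀ {m x xs} → IsPartition m (x ∷ xs) → x ≤ m
head≤sum {x = x} {xs} π = subst (x ≤_) (sumEq π) (m≤m+n x (sum xs))

IsPartition-∷ : ∀ {k x xs} → 0 < x → All (_≤ x) xs → IsPartition k xs → IsPartition (x ℕ.+ k) (x ∷ xs)
IsPartition-∷ {x = x} 0<x xs≤x π = record
  { positive = 0<x ∷ positive π
  ; nonIncr  = descending xs≤x (nonIncr π)
  ; sumEq    = cong (x ℕ.+_) (sumEq π)
  }
  where
  descending : ∀ {ys} → All (_≤ x) ys → Linked _≥_ ys → Linked _≥_ (x ∷ ys)
  descending []         []  = [-]
  descending (y≤x ∷ _)  ys↓ = y≤x ∷ ys↓

IsPartition-tail : ∀ {m k x xs} → IsPartition m (x ∷ xs) → sum xs ≡ k → IsPartition k xs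
IsPartition-tail π Σxs≡k = record
  { positive = All.tail (positive π)
  ; nonIncr  = Linked.tail (nonIncr π)
  ; sumEq    = Σxs≡k
  }

split-largest : ∀ N m →
  Partition≤ (suc N) m ↔ (Partition≤ N m ⊎ (suc N ≤ m × Partition≤ (suc N) (m ∸ suc N)))
split-largest N m = mk↔ₛ′ to from to∘from from∘to
  where
  Target : Set
  Target = Partition≤ N m ⊎ (suc N ≤ m × Partition≤ (suc N) (m ∸ suc N))

  to : Partition≤ (suc N) m → Target
  to ([] , π , []) = inj₁ ([] , π , [])
  to (x ∷ xs , π , x≤1+N ∷ _) with x ℕ.≟ suc N
  ... | yes refl = inj₂ (head≤sum π , xs , IsPartition-tail π Σxs≡m∸x , parts≤head π)
    where Σxs≡m∸x = trans (sym (m+n∸m≡n (suc N) (sum xs))) (cong (_∸ suc N) (sumEq π))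
  ... | no  x≢1+N = inj₁ (x ∷ xs , π , x≤N ∷ All.map (flip ≤-trans x≤N) (parts≤head π))
    where x≤N = ≤-pred (≤∧≢⇒< x≤1+N x≢1+N)

  from : Target → Partition≤ (suc N) m
  from (inj₁ (xs , π , xs≤N)) = xs , π , All.map m≤n⇒m≤1+n xs≤N
  from (inj₂ (N<m , xs , π , xs≤1+N)) =
    suc N ∷ xs , subst (λ k → IsPartition k _) (m+[n∸m]≡n N<m) (IsPartition-∷ z<s xs≤1+N π)
               , ≤-refl ∷ xs≤1+N

  to∘from : ∀ p → to (from p) ≡ p
  to∘from (inj₁ ([] , π , [])) = refl
  to∘from (inj₁ (x ∷ xs , π , x≤N ∷ _)) with x ℕ.≟ suc N
  ... | yes refl = ⊥-elim (<⇒≱ x≤N ≤-refl)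
  ... | no  _    = cong inj₁ (Partition≤-≡ refl)
  to∘from (inj₂ (N<m , xs , π , _)) with suc N ℕ.≟ suc N
  ... | yes refl = cong inj₂ (cong₂ _,_ (≤-irrelevant _ _) (Partition≤-≡ refl))
  ... | no  N≢N  = ⊥-elim (N≢N refl)

  from∘to : ∀ p → from (to p) ≡ p
  from∘to ([] , π , []) = Partition≤-≡ refl
  from∘to (x ∷ xs , π , _ ∷ _) with x ℕ.≟ suc N
  ... | yes refl = Partition≤-≡ refl
  ... | no  _    = Partition≤-≡ refl

Fin-shift↔ : ∀ s m {C : ℕ → ℕ} {P : ℕ → Set} → (s ≤ m → Fin (C (m ∸ s)) ↔ P (m ∸ s)) →
             Fin (shift 0 s C m) ↔ (s ≤ m × P (m ∸ s))
Fin-shift↔ zero    m       C↔P =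
  ↔-trans (C↔P z≤n) (mk↔ₛ′ (z≤n ,_) proj₂ (λ { (z≤n , _) → refl }) (λ _ → refl))
Fin-shift↔ (suc s) zero    C↔P = mk↔ₛ′ (λ ()) (λ { (() , _) }) (λ { (() , _) }) (λ ())
Fin-shift↔ (suc s) (suc m) {C} {P} C↔P = ↔-trans (Fin-shift↔ s m {C} {P} (C↔P ∘ s≤s))
  (mk↔ₛ′ (λ (s≤m , p) → s≤s s≤m , p) (λ (s<m , p) → ≤-pred s<m , p)
         (λ { (s≤s _ , _) → refl }) (λ _ → refl))

-- p≤′ f N m counts the partitions of m into parts ≤ N as long as the fuel f
-- exceeds m (it is junk otherwise); the fuel makes the recursion structural.
p≤′ : ℕ → ℕ → ℕ → ℕ
p≤′ zero    _       _       = 0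
p≤′ (suc f) zero    zero    = 1
p≤′ (suc f) zero    (suc m) = 0
p≤′ (suc f) (suc N) m       = p≤′ (suc f) N m ℕ.+ shift 0 (suc N) (p≤′ f (suc N)) m

p≤ : ℕ → ℕ → ℕ
p≤ N m = p≤′ (suc m) N m

Fin-p≤′↔ : ∀ {f} N m → m < f → Fin (p≤′ f N m) ↔ Partition≤ N m
Fin-p≤′↔ {suc f} zero zero _ = mk↔ₛ′ (λ _ → [] , π₀ , []) (λ _ → zero) only-[] (λ { zero → refl })
  where
  π₀ : IsPartition 0 []
  π₀ = record { positive = [] ; nonIncr = [] ; sumEq = refl }
  only-[] : ∀ p → ([] , π₀ , []) ≡ p
  only-[] ([] , _)                 = Partition≤-≡ refl
  only-[] (_ ∷ _ , π , x≤0 ∷ _)    = ⊥-elim (<⇒≱ (All.head (positive π)) x≤0)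
Fin-p≤′↔ {suc f} zero (suc m) _ = mk↔ₛ′ (λ ()) (⊥-elim ∘ none) (⊥-elim ∘ none) (λ ())
  where
  none : Partition≤ 0 (suc m) → ⊥
  none ([] , π , _)            with () ← sumEq π
  none (_ ∷ _ , π , x≤0 ∷ _)   = <⇒≱ (All.head (positive π)) x≤0
Fin-p≤′↔ {suc f} (suc N) m m<1+f =
  ↔-trans +↔⊎ (↔-trans (Fin-p≤′↔ N m m<1+f ⊎-↔ Fin-shift↔ (suc N) m {P = Partition≤ (suc N)} smaller)
                       (↔-sym (split-largest N m)))
  where
  smaller : suc N ≤ m → Fin (p≤′ f (suc N) (m ∸ suc N)) ↔ Partition≤ (suc N) (m ∸ suc N)
  smaller N<m = Fin-p≤′↔ (suc N) (m ∸ suc N) (<-≤-trans (∸-monoʳ-< z<s N<m) (≤-pred m<1+f))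

p≤′-fuel-irrelevant : ∀ {f f′} N m → m < f → m < f′ → p≤′ f N m ≡ p≤′ f′ N m
p≤′-fuel-irrelevant N m m<f m<f′ = ↔⇒≡ (↔-trans (Fin-p≤′↔ N m m<f) (↔-sym (Fin-p≤′↔ N m m<f′)))

Fin-p≤↔ : ∀ N m → Fin (p≤ N m) ↔ Partition≤ N m
Fin-p≤↔ N m = Fin-p≤′↔ N m ≤-refl

p≤-suc : ∀ N m → p≤ (suc N) m ≡ p≤ N m ℕ.+ shift 0 (suc N) (p≤ (suc N)) m
p≤-suc N m = cong (p≤ N m ℕ.+_) (shift-cong (suc N) m enough-fuel)
  where
  enough-fuel : ∀ x → suc N ℕ.+ x ≡ m → p≤′ m (suc N) x ≡ p≤ (suc N) x
  enough-fuel x refl = p≤′-fuel-irrelevant (suc N) x (s≤s (m≤n+m x N)) ≤-refl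

partitionCount : ℕ → ℕ
partitionCount m = p≤ m m

p≤-stable : ∀ {m N} → m ≤ N → p≤ N m ≡ partitionCount m
p≤-stable = go ∘ ≤⇒≤′
  where
  go : ∀ {m N} → m ≤′ N → p≤ N m ≡ partitionCount m
  go ≤′-refl = refl
  go {m} (≤′-step {N} m≤′N) = begin
    p≤ (suc N) m
      ≡⟨ p≤-suc N m ⟩
    p≤ N m ℕ.+ shift 0 (suc N) (p≤ (suc N)) m
      ≡⟨ cong (p≤ N m ℕ.+_) (shift-below (suc N) m (s≤s (≤′⇒≤ m≤′N))) ⟩
    p≤ N m ℕ.+ 0
      ≡⟨ +-identityʳ _ ⟩
    p≤ N m
      ≡⟨ go m≤′N ⟩
    partitionCount m ∎
    where open ≡-Reasoning

p≤-zero : ∀ N → p≤ N 0 ≡ 1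
p≤-zero zero    = refl
p≤-zero (suc N) = trans (+-identityʳ _) (p≤-zero N)

p≤-one : ∀ m → p≤ 1 m ≡ 1
p≤-one zero    = refl
p≤-one (suc m) = trans (p≤-suc 0 (suc m)) (p≤-one m)

-- Exactly one partition of ℓ has a part ℓ.
p≤-diagonal : ∀ h → p≤ (suc h) (suc h) ≡ p≤ h (suc h) ℕ.+ 1
p≤-diagonal h = trans (p≤-suc h (suc h)) (cong (p≤ h (suc h) ℕ.+_) (trans (shift-self (suc h)) (p≤-zero (suc h))))

-- spread C = Σ C m q^{2m}
spread : (ℕ → ℕ) → FPS
spread C zero          = + C 0
spread C (suc zero)    = + 0
spread C (suc (suc n)) = spread (C ∘ suc) n

spread-double : ∀ C h → spread C (h ℕ.+ h) ≡ + C h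
spread-double C zero    = refl
spread-double C (suc h) rewrite +-suc h h = spread-double (C ∘ suc) h

spread-odd : ∀ C h → spread C (suc (h ℕ.+ h)) ≡ + 0
spread-odd C zero    = refl
spread-odd C (suc h) rewrite +-suc h h = spread-odd (C ∘ suc) h

spread-cong : ∀ n {C D} → (∀ m → m ≤ n → C m ≡ D m) → spread C n ≡ spread D n
spread-cong zero          C≗D = cong +_ (C≗D 0 z≤n)
spread-cong (suc zero)    C≗D = refl
spread-cong (suc (suc n)) C≗D = spread-cong n (λ m m≤n → C≗D (suc m) (m≤n⇒m≤1+n (s≤s m≤n)))

spread-+ : ∀ C D n → spread (λ m → C m ℕ.+ D m) n ≡ spread C n + spread D n
spread-+ C D zero          = ℤ.pos-+ (C 0) (D 0)
spread-+ C D (suc zero)    = refl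
spread-+ C D (suc (suc n)) = spread-+ (C ∘ suc) (D ∘ suc) n

spread-zero : ∀ n → spread (λ _ → 0) n ≡ + 0
spread-zero zero          = refl
spread-zero (suc zero)    = refl
spread-zero (suc (suc n)) = spread-zero n

shift-spread : ∀ t C n → shift (+ 0) (t ℕ.+ t) (spread C) n ≡ spread (shift 0 t C) n
shift-spread zero    C n             = refl
shift-spread (suc t) C zero          = refl
shift-spread (suc t) C (suc zero) rewrite +-suc t t = refl
shift-spread (suc t) C (suc (suc n)) rewrite +-suc t t = shift-spread t C n

spread-p≤0 : ∀ n → spread (p≤ 0) n ≡ one n
spread-p≤0 zero          = refl
spread-p≤0 (suc zero)    = refl
spread-p≤0 (suc (suc n)) = spread-zero n

-- Multiplying by 1 − q^{2(N+1)} undoes the choice of how often N + 1 is a part.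
one-⊖-q²⁽ᴺ⁺¹⁾-⋆ : ∀ N n →
  ((one ⊖ mono (2 ℕ.* suc N)) ⋆ spread (p≤ (suc N))) n ≡ spread (p≤ N) n
one-⊖-q²⁽ᴺ⁺¹⁾-⋆ N n = begin
  ((one ⊖ mono (2 ℕ.* M)) ⋆ spread (p≤ M)) n
    ≡⟨ one-⊖-mono-⋆ (2 ℕ.* M) (spread (p≤ M)) n ⟩
  spread (p≤ M) n - shift (+ 0) (2 ℕ.* M) (spread (p≤ M)) n
    ≡⟨ cong (λ s → spread (p≤ M) n - shift (+ 0) s (spread (p≤ M)) n) (cong (M ℕ.+_) (+-identityʳ M)) ⟩
  spread (p≤ M) n - shift (+ 0) (M ℕ.+ M) (spread (p≤ M)) n
    ≡⟨ cong₂ _-_ (spread-cong n (λ m _ → p≤-suc N m)) (shift-spread M (p≤ M) n) ⟩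
  spread (λ m → p≤ N m ℕ.+ Removed m) n - spread Removed n
    ≡⟨ cong (_- spread Removed n) (spread-+ (p≤ N) Removed n) ⟩
  (spread (p≤ N) n + spread Removed n) - spread Removed n
    ≡⟨ x+y-y≡x (spread (p≤ N) n) (spread Removed n) ⟩
  spread (p≤ N) n ∎
  where
  open ≡-Reasoning
  M : ℕ
  M = suc N
  Removed : ℕ → ℕ
  Removed = shift 0 M (p≤ M)

poch2-inverse : ∀ N → IsInverse (poch2 N) (spread (p≤ N))
poch2-inverse zero    n = trans (⋆-identityˡ (spread (p≤ 0)) n) (spread-p≤0 n)
poch2-inverse (suc N) n = begin
  ((poch2 N ⋆ B) ⋆ spread (p≤ (suc N))) n
    ≡⟨ ⋆-assoc (poch2 N) B (spread (p≤ (suc N))) n ⟩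
  (poch2 N ⋆ (B ⋆ spread (p≤ (suc N)))) n
    ≡⟨ ⋆-cong (poch2 N) (B ⋆ spread (p≤ (suc N))) n (λ _ _ → refl) (λ k _ → one-⊖-q²⁽ᴺ⁺¹⁾-⋆ N k) ⟩
  (poch2 N ⋆ spread (p≤ N)) n
    ≡⟨ poch2-inverse N n ⟩
  one n ∎
  where
  open ≡-Reasoning
  B : FPS
  B = one ⊖ mono (2 ℕ.* suc N)

poch2-stable : ∀ {k N} → k ≤ N → poch2 N k ≡ poch2∞ k
poch2-stable = go ∘ ≤⇒≤′
  where
  go : ∀ {k N} → k ≤′ N → poch2 N k ≡ poch2∞ k
  go ≤′-refl = refl
  go {k} (≤′-step {N} k≤′N) = trans (⋆-identityʳ-upTo (poch2 N) _ k factor≗one) (go k≤′N)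
    where
    factor≗one : ∀ j → j ≤ k → (one ⊖ mono (2 ℕ.* suc N)) j ≡ one j
    factor≗one j j≤k =
      one-⊖-mono-below (<-≤-trans (s≤s (≤-trans j≤k (≤′⇒≤ k≤′N))) (m≤m+n (suc N) _))

spread-p≤-stable : ∀ {k N} → k ≤ N → spread (p≤ N) k ≡ spread partitionCount k
spread-p≤-stable {k} k≤N = spread-cong k (λ m m≤k → p≤-stable (≤-trans m≤k k≤N))

poch2∞-inverse : IsInverse poch2∞ (spread partitionCount)
poch2∞-inverse = inverse-limit poch2 (spread ∘ p≤) poch2-inverse poch2-stable spread-p≤-stable

oneMinusQ2-inverse : IsInverse oneMinusQ2 (spread λ _ → 1)
oneMinusQ2-inverse n =
  trans (⋆-cong oneMinusQ2 (spread λ _ → 1) n (λ k _ → sym (⋆-identityˡ oneMinusQ2 k))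
                                             (λ m _ → spread-cong m (λ j _ → sym (p≤-one j))))
        (poch2-inverse 1 n)

double-injective : ∀ {a b} → a ℕ.+ a ≡ b ℕ.+ b → a ≡ b
double-injective {a} {b} e = trans (n≡⌊n+n/2⌋ a) (trans (cong ℕ.⌊_/2⌋ e) (sym (n≡⌊n+n/2⌋ b)))

double≢odd : ∀ a b → a ℕ.+ a ≢ suc (b ℕ.+ b)
double≢odd zero    _       ()
double≢odd (suc a) zero    e with () ← trans (sym (+-suc a a)) (suc-injective e)
double≢odd (suc a) (suc b) e =
  double≢odd a b (suc-injective (trans (sym (+-suc a a)) (trans (suc-injective e) (cong suc (+-suc b b)))))

ΛPartition-≡ : ∀ {n} {p q : ΛPartition n} → proj₁ p ≡ proj₁ q → p ≡ q
ΛPartition-≡ = Σ-≡-proj₁ λ (π , t) (π′ , t′) →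
  cong₂ _,_ (IsPartition-irrelevant π π′) (TypeΛ-irrelevant t t′)
  where
  TypeΛ-irrelevant : ∀ {xs} → Irrelevant (TypeΛ xs)
  TypeΛ-irrelevant {_ ∷ _} (a , s) (a′ , s′) =
    cong₂ _,_ (All.irrelevant <-irrelevant a a′) (≡-irrelevant s s′)

ΛPartition-size : ∀ {n} → ΛPartition n → ∃[ h ] n ≡ suc h ℕ.+ suc h
ΛPartition-size (zero  ∷ _    , π , _)         with () ← All.head (positive π)
ΛPartition-size (suc h ∷ rest , π , _ , Σ≡1+h) = h , trans (sym (sumEq π)) (cong (suc h ℕ.+_) Σ≡1+h)

ΛPartition↔Partition≤ : ∀ h → ΛPartition (suc h ℕ.+ suc h) ↔ Partition≤ h (suc h)
ΛPartition↔Partition≤ h = mk↔ₛ′ to from (λ _ → Partition≤-≡ refl) from∘to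
  where
  largest≡ : ∀ {ℓ rest} → IsPartition (suc h ℕ.+ suc h) (ℓ ∷ rest) → sum rest ≡ ℓ → ℓ ≡ suc h
  largest≡ {ℓ} π Σ≡ℓ = double-injective (trans (cong (ℓ ℕ.+_) (sym Σ≡ℓ)) (sumEq π))

  to : ΛPartition (suc h ℕ.+ suc h) → Partition≤ h (suc h)
  to (ℓ ∷ rest , π , rest<ℓ , Σ≡ℓ) =
    rest , IsPartition-tail π (trans Σ≡ℓ ℓ≡1+h)
         , All.map (λ x<ℓ → ≤-pred (subst (_ <_) ℓ≡1+h x<ℓ)) rest<ℓ
    where ℓ≡1+h = largest≡ π Σ≡ℓ

  from : Partition≤ h (suc h) → ΛPartition (suc h ℕ.+ suc h)
  from (rest , π , rest≤h) =
    suc h ∷ rest , IsPartition-∷ z<s (All.map m≤n⇒m≤1+n rest≤h) π , All.map s≤s rest≤h , sumEq π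

  from∘to : ∀ p → from (to p) ≡ p
  from∘to (ℓ ∷ rest , π , _ , Σ≡ℓ) = ΛPartition-≡ (cong (_∷ rest) (sym (largest≡ π Σ≡ℓ)))

ΛPartition-zero-empty : ¬ ΛPartition 0
ΛPartition-zero-empty λp with ΛPartition-size λp
... | _ , ()

ΛPartition-odd-empty : ∀ h → ¬ ΛPartition (suc (h ℕ.+ h))
ΛPartition-odd-empty h λp with ΛPartition-size λp
... | ℓ , odd≡double = double≢odd (suc ℓ) h (sym odd≡double)

Fin↔-empty : ∀ {k} {A : Set} → Fin k ↔ A → ¬ A → k ≡ 0
Fin↔-empty {zero}  _     _  = refl
Fin↔-empty {suc k} Fin↔A ¬A = ⊥-elim (¬A (Inverse.to Fin↔A zero))

data Parity : ℕ → Set where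
  even : ∀ h → Parity (h ℕ.+ h)
  odd  : ∀ h → Parity (suc (h ℕ.+ h))

parity : ∀ n → Parity n
parity zero          = even 0
parity (suc zero)    = odd 0
parity (suc (suc n)) with parity n
... | even h = subst Parity (cong suc (+-suc h h)) (even (suc h))
... | odd  h = subst Parity (cong (suc ∘ suc) (+-suc h h)) (odd (suc h))

ΛPartition-count : ∀ {n k} → Fin k ↔ ΛPartition n →
                   + k ≡ spread partitionCount n - spread (λ _ → 1) n
ΛPartition-count {n} {k} Fin↔Λ with parity n
... | odd h = trans (cong +_ (Fin↔-empty Fin↔Λ (ΛPartition-odd-empty h)))
                    (sym (cong₂ _-_ (spread-odd partitionCount h) (spread-odd (λ _ → 1) h)))
... | even zero = cong +_ (Fin↔-empty Fin↔Λ ΛPartition-zero-empty)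
... | even (suc h) = begin
  + k
    ≡⟨ cong +_ (↔⇒≡ (↔-trans Fin↔Λ (↔-trans (ΛPartition↔Partition≤ h) (↔-sym (Fin-p≤↔ h (suc h)))))) ⟩
  + p≤ h (suc h)
    ≡⟨ x+y-y≡x (+ p≤ h (suc h)) (+ 1) ⟨
  + p≤ h (suc h) + + 1 - + 1
    ≡⟨ cong (_- + 1) (ℤ.pos-+ (p≤ h (suc h)) 1) ⟨
  + (p≤ h (suc h) ℕ.+ 1) - + 1
    ≡⟨ cong (λ x → + x - + 1) (p≤-diagonal h) ⟨
  + partitionCount (suc h) - + 1
    ≡⟨ cong₂ _-_ (spread-double partitionCount (suc h)) (spread-double (λ _ → 1) (suc h)) ⟨
  spread partitionCount (suc h ℕ.+ suc h) - spread (λ _ → 1) (suc h ℕ.+ suc h) ∎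
  where open ≡-Reasoning

theorem1 : (P⁻¹ G : FPS) → IsInverse poch2∞ P⁻¹ → IsInverse oneMinusQ2 G →
    (n k : ℕ) → (Fin k ↔ ΛPartition n) → + k ≡ P⁻¹ n - G n
theorem1 P⁻¹ G P⁻¹-inverse G-inverse n k Fin↔Λ = begin
  + k
    ≡⟨ ΛPartition-count Fin↔Λ ⟩
  spread partitionCount n - spread (λ _ → 1) n
    ≡⟨ cong₂ _-_ (inverse-unique poch2∞ (spread partitionCount) P⁻¹ refl poch2∞-inverse P⁻¹-inverse n)
                 (inverse-unique oneMinusQ2 (spread λ _ → 1) G refl oneMinusQ2-inverse G-inverse n) ⟩
  P⁻¹ n - G n ∎
  where open ≡-Reasoning
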